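{- For every positive integer $m$ there exist positive integers $a$ and $b$ such that $am>b$ and \[\binom{amn}{bn}\equiv 0\pmod{an-1}\] for all integers $n\geq 1$. -}

module Defs where

-- Put x = 2k − 1 and N = m(x + 1). Peeling m + 1 factors off the binomial coefficient gives
--   C(N, k) · k(k − 1)⋯(k − m) = N(N − 1)⋯(N − m) · C(N − m − 1, k − m − 1),
-- and N − m = m·x, so x divides C(N, k) as soon as x is coprime to each k − i, i ≤ m.
-- As 2(k − i) = x − (2i − 1), a common divisor of x and k − i divides 2i − 1; when all odd
-- numbers below 2m divide k it divides k, hence x + 1 = 2k, hence 1. Now take k = (2m)!·n,
-- i.e. a = 2·(2m)! and b = (2m)!.
module Submission where

open import Defs
open import Data.Nat using (ℕ; _*_; _∸_; _<_; _≤_)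
open import Data.Nat.Divisibility using (_∣_)
open import Data.Nat.Combinatorics using (_C_)
open import Data.Product using (Σ; _×_)

open import Data.Nat.Base using (zero; suc; _+_; _!; NonZero; >-nonZero; z≤n; s≤s)
open import Data.Nat.Properties
open import Data.Nat.Divisibility
  using (∣-trans; ∣1⇒≡1; ∣m+n∣m⇒∣n; ∣n⇒∣m*n; ∣m⇒∣m*n; n∣m*n; m∣m*n; ∣⇒≤; m≤n⇒m!∣n!)
open import Data.Nat.DivMod using (m/n*n≡m)
open import Data.Nat.Combinatorics using (nCk≡n!/k![n-k]!; k![n∸k]!∣n!)
open import Data.Nat.Combinatorics.Base using (_P′_)
open import Data.Nat.Combinatorics.Specification using (nP′k≡n!/[n∸k]!)
open import Data.Nat.Coprimality using (Coprime; coprime-divisor; 1-coprimeTo)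
import Data.Nat.Coprimality as Coprime
open import Data.Nat.Tactic.RingSolver using (solve-∀)
open import Data.Product using (_,_)
open import Function using (_∘_)
open import Relation.Binary.PropositionalEquality
  using (_≡_; sym; trans; cong; subst; subst₂; module ≡-Reasoning)

n<2*n : ∀ {n} → .{{NonZero n}} → n < 2 * n
n<2*n {suc n} = m<m+n (suc n) (s≤s z≤n)

m≤n⇒m∣n! : ∀ {m n} → .{{NonZero m}} → m ≤ n → m ∣ n !
m≤n⇒m∣n! {suc m} m≤n = ∣-trans (m∣m*n (m !)) (m≤n⇒m!∣n! m≤n)

nP′k*[n∸k]!≡n! : ∀ {n k} → k ≤ n → (n P′ k) * (n ∸ k) ! ≡ n !
nP′k*[n∸k]!≡n! {n} {k} k≤n =
  trans (cong (_* (n ∸ k) !) (nP′k≡n!/[n∸k]! k≤n)) (m/n*n≡m (m≤n⇒m!∣n! (m∸n≤m n k)))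
  where instance _ = (n ∸ k) !≢0

nCk*k![n∸k]!≡n! : ∀ {n k} → k ≤ n → (n C k) * (k ! * (n ∸ k) !) ≡ n !
nCk*k![n∸k]!≡n! {n} {k} k≤n =
  trans (cong (_* (k ! * (n ∸ k) !)) (nCk≡n!/k![n-k]! k≤n)) (m/n*n≡m (k![n∸k]!∣n! k≤n))
  where instance _ = k !* (n ∸ k) !≢0

nCk*kP′j≡nP′j*[n∸j]C[k∸j] : ∀ {n k j} → j ≤ k → k ≤ n →
                            (n C k) * (k P′ j) ≡ (n P′ j) * ((n ∸ j) C (k ∸ j))
nCk*kP′j≡nP′j*[n∸j]C[k∸j] {n} {k} {j} j≤k k≤n =
  *-cancelʳ-≡ _ _ ((k ∸ j) ! * (n ∸ k) !) {{(k ∸ j) !* (n ∸ k) !≢0}} (trans lhs≡n! (sym rhs≡n!))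
  where
  open ≡-Reasoning
  [n∸j]∸[k∸j]≡n∸k : (n ∸ j) ∸ (k ∸ j) ≡ n ∸ k
  [n∸j]∸[k∸j]≡n∸k = trans (∸-+-assoc n j (k ∸ j)) (cong (n ∸_) (m+[n∸m]≡n j≤k))

  lhs≡n! : (n C k) * (k P′ j) * ((k ∸ j) ! * (n ∸ k) !) ≡ n !
  lhs≡n! = begin
    (n C k) * (k P′ j) * ((k ∸ j) ! * (n ∸ k) !)
      ≡⟨ *-assoc (n C k) (k P′ j) _ ⟩
    (n C k) * ((k P′ j) * ((k ∸ j) ! * (n ∸ k) !))
      ≡⟨ cong ((n C k) *_) (sym (*-assoc (k P′ j) _ _)) ⟩
    (n C k) * ((k P′ j) * (k ∸ j) ! * (n ∸ k) !)
      ≡⟨ cong (λ z → (n C k) * (z * (n ∸ k) !)) (nP′k*[n∸k]!≡n! j≤k) ⟩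
    (n C k) * (k ! * (n ∸ k) !)
      ≡⟨ nCk*k![n∸k]!≡n! k≤n ⟩
    n !
      ∎

  rhs≡n! : (n P′ j) * ((n ∸ j) C (k ∸ j)) * ((k ∸ j) ! * (n ∸ k) !) ≡ n !
  rhs≡n! = begin
    (n P′ j) * ((n ∸ j) C (k ∸ j)) * ((k ∸ j) ! * (n ∸ k) !)
      ≡⟨ *-assoc (n P′ j) _ _ ⟩
    (n P′ j) * (((n ∸ j) C (k ∸ j)) * ((k ∸ j) ! * (n ∸ k) !))
      ≡⟨ cong (λ z → (n P′ j) * (((n ∸ j) C (k ∸ j)) * ((k ∸ j) ! * z !))) (sym [n∸j]∸[k∸j]≡n∸k) ⟩
    (n P′ j) * (((n ∸ j) C (k ∸ j)) * ((k ∸ j) ! * ((n ∸ j) ∸ (k ∸ j)) !))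
      ≡⟨ cong ((n P′ j) *_) (nCk*k![n∸k]!≡n! (∸-monoˡ-≤ j k≤n)) ⟩
    (n P′ j) * (n ∸ j) !
      ≡⟨ nP′k*[n∸k]!≡n! (≤-trans j≤k k≤n) ⟩
    n !
      ∎

∣P′∧coprime⇒∣C : ∀ {x n k j} → j ≤ k → k ≤ n → Coprime x (k P′ j) → x ∣ n P′ j → x ∣ n C k
∣P′∧coprime⇒∣C {x} {n} {k} {j} j≤k k≤n x⊥kP′j x∣nP′j = coprime-divisor x⊥kP′j x∣kP′j*nCk
  where
  x∣kP′j*nCk : x ∣ (k P′ j) * (n C k)
  x∣kP′j*nCk = subst (x ∣_) (trans (sym (nCk*kP′j≡nP′j*[n∸j]C[k∸j] j≤k k≤n)) (*-comm (n C k) _))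
                 (∣m⇒∣m*n ((n ∸ j) C (k ∸ j)) x∣nP′j)

m*[1+n]∸m≡m*n : ∀ m n → m * suc n ∸ m ≡ m * n
m*[1+n]∸m≡m*n m n = trans (cong (_∸ m) (*-suc m n)) (m+n∸m≡n m (m * n))

n∣[m*[1+n]]P′[1+m] : ∀ m n → n ∣ (m * suc n) P′ suc m
n∣[m*[1+n]]P′[1+m] m n = ∣m⇒∣m*n _ (subst (n ∣_) (sym (m*[1+n]∸m≡m*n m n)) (n∣m*n m))

coprime-* : ∀ {x m n} → Coprime x m → Coprime x n → Coprime x (m * n)
coprime-* {x} {m} x⊥m x⊥n {d} (d∣x , d∣mn) = x⊥n (d∣x , coprime-divisor d⊥m d∣mn)
  where
  d⊥m : Coprime d m
  d⊥m (e∣d , e∣m) = x⊥m (∣-trans e∣d d∣x , e∣m)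

coprime-P′ : ∀ {x n} j → (∀ {i} → i < j → Coprime x (n ∸ i)) → Coprime x (n P′ j)
coprime-P′ zero    _     = Coprime.sym (1-coprimeTo _)
coprime-P′ (suc j) x⊥n∸i = coprime-* (x⊥n∸i (n<1+n j)) (coprime-P′ j (x⊥n∸i ∘ m<n⇒m<1+n))

coprime-[2n∸1]-n : ∀ {n} → .{{NonZero n}} → Coprime (2 * n ∸ 1) n
coprime-[2n∸1]-n {n@(suc _)} {d} (d∣2n∸1 , d∣n) = ∣1⇒≡1 (∣m+n∣m⇒∣n d∣2n∸1+1 d∣2n∸1)
  where
  d∣2n∸1+1 : d ∣ (2 * n ∸ 1) + 1
  d∣2n∸1+1 = subst (d ∣_) (sym (m∸n+n≡m (s≤s z≤n))) (∣n⇒∣m*n 2 d∣n)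

2n∸1≡2[n∸[1+i]]+[1+2i] : ∀ {n i} → i < n → 2 * n ∸ 1 ≡ 2 * (n ∸ suc i) + (1 + 2 * i)
2n∸1≡2[n∸[1+i]]+[1+2i] {n} {i} i<n = begin
  2 * n ∸ 1                      ≡⟨ cong (λ n → 2 * n ∸ 1) (sym (m+[n∸m]≡n i<n)) ⟩
  2 * (suc i + (n ∸ suc i)) ∸ 1  ≡⟨ cong (_∸ 1) (double-expand i (n ∸ suc i)) ⟩
  2 * (n ∸ suc i) + (1 + 2 * i)  ∎
  where
  open ≡-Reasoning
  double-expand : ∀ i r → 2 * (suc i + r) ≡ suc (2 * r + (1 + 2 * i))
  double-expand = solve-∀

coprime-[2n∸1]-[n∸[1+i]] : ∀ {n i} → 1 + 2 * i ∣ n → i < n → Coprime (2 * n ∸ 1) (n ∸ suc i)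
coprime-[2n∸1]-[n∸[1+i]] {n@(suc _)} {i} 1+2i∣n i<n {d} (d∣2n∸1 , d∣n∸[1+i]) =
  coprime-[2n∸1]-n (d∣2n∸1 , ∣-trans d∣1+2i 1+2i∣n)
  where
  d∣1+2i : d ∣ 1 + 2 * i
  d∣1+2i = ∣m+n∣m⇒∣n (subst (d ∣_) (2n∸1≡2[n∸[1+i]]+[1+2i] i<n) d∣2n∸1) (∣n⇒∣m*n 2 d∣n∸[1+i])

coprime-[2k∸1]-[kP′[1+m]] : ∀ {m k} → m < k → (∀ {i} → i < m → 1 + 2 * i ∣ k) →
                            Coprime (2 * k ∸ 1) (k P′ suc m)
coprime-[2k∸1]-[kP′[1+m]] {m} {k@(suc _)} m<k odd∣k = coprime-P′ (suc m) coprime-k∸i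
  where
  coprime-k∸i : ∀ {i} → i < suc m → Coprime (2 * k ∸ 1) (k ∸ i)
  coprime-k∸i {zero}  _         = coprime-[2n∸1]-n
  coprime-k∸i {suc i} (s≤s i<m) = coprime-[2n∸1]-[n∸[1+i]] (odd∣k i<m) (<-trans i<m m<k)

2k∸1∣[m*2k]Ck : ∀ {m k} → .{{NonZero m}} → m < k → (∀ {i} → i < m → 1 + 2 * i ∣ k) →
                2 * k ∸ 1 ∣ (m * (2 * k)) C k
2k∸1∣[m*2k]Ck {m} {k@(suc _)} m<k odd∣k =
  ∣P′∧coprime⇒∣C m<k k≤m*2k (coprime-[2k∸1]-[kP′[1+m]] m<k odd∣k)
    -- typechecks as is: for k = suc _, 2 * k reduces to suc (2 * k ∸ 1)
    (n∣[m*[1+n]]P′[1+m] m (2 * k ∸ 1))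
  where
  k≤m*2k : k ≤ m * (2 * k)
  k≤m*2k = ≤-trans (m≤n*m k 2) (m≤n*m (2 * k) m)

mainTheorem4 : (m : ℕ) → 1 ≤ m →
    Σ ℕ (λ a → Σ ℕ (λ b → 1 ≤ a × 1 ≤ b × b < a * m ×
      ((n : ℕ) → 1 ≤ n → (a * n ∸ 1) ∣ ((a * m * n) C (b * n)))))
mainTheorem4 m 1≤m = 2 * c , c , ≤-trans 1≤c (m≤n*m c 2) , 1≤c , c<2c*m , divisibility
  where
  c = (2 * m) !
  instance
    _ = >-nonZero 1≤m
    _ = m*n≢0 2 m
    _ = (2 * m) !≢0

  1≤c : 1 ≤ c
  1≤c = 1≤n! (2 * m)

  c<2c*m : c < 2 * c * m
  c<2c*m = ≤-trans n<2*n (m≤m*n (2 * c) m)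

  1+2i∣c : ∀ {i} → i < m → 1 + 2 * i ∣ c
  1+2i∣c {i} i<m = m≤n⇒m∣n! 1+2i≤2m
    where
    1+2i≤2m : 1 + 2 * i ≤ 2 * m
    1+2i≤2m = ≤-trans (n≤1+n (1 + 2 * i)) (subst (_≤ 2 * m) (*-suc 2 i) (*-monoʳ-≤ 2 i<m))

  divisibility : (n : ℕ) → 1 ≤ n → (2 * c * n ∸ 1) ∣ ((2 * c * m * n) C (c * n))
  divisibility n 1≤n = subst₂ (λ a N → a ∸ 1 ∣ N C (c * n)) (sym (*-assoc 2 c n)) (regroup m c n)
    (2k∸1∣[m*2k]Ck m<cn (λ i<m → ∣-trans (1+2i∣c i<m) (m∣m*n n)))
    where
    instance _ = >-nonZero 1≤n

    m<cn : m < c * n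
    m<cn = ≤-trans n<2*n (≤-trans (∣⇒≤ (m≤n⇒m∣n! ≤-refl)) (m≤m*n c n))

    regroup : ∀ m c n → m * (2 * (c * n)) ≡ 2 * c * m * n
    regroup = solve-∀
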